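{- For every integer $n\ge 0$, \[ \sum_{k=-\infty}^{\infty}(-1)^k\,\overline{p}_o\!\left(n-\frac{k(3k+1)}{2}\right)=\sum_{k=-\infty}^{\infty}(-1)^k\,p_{do}\bigl(n-k(3k+1)\bigr). \]
   Context: $\overline{p}_o(n)$ is the number of overpartitions of $n$ into odd parts (partitions into odd parts in which the first occurrence of each part size may be overlined), with $\sum_{n\ge0}\overline{p}_o(n)q^n=\frac{(-q;q^2)_\infty}{(q;q^2)_\infty}$, where $(a;q)_\infty=\prod_{k\ge1}(1-aq^{k-1})$. $p_{do}(n)$ is the number of partitions of $n$ into distinct odd parts, $\sum_{n\ge0}p_{do}(n)q^n=(-q;q^2)_\infty$. Convention: these functions vanish at arguments that are not nonnegative integers. -}

module Defs where

open import Data.Nat as ℕ using (ℕ; zero; suc; _∸_; _≤?_)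
open import Data.Nat.DivMod using (_/_)
open import Data.Bool using (Bool; true; false; if_then_else_; _∧_)
open import Data.Integer as ℤ using (ℤ; +_; -[1+_]; ∣_∣)
open import Relation.Nullary.Decidable using (does)

odd? : ℕ → Bool
odd? zero          = false
odd? (suc zero)    = true
odd? (suc (suc j)) = odd? j

[_]ₙ : Bool → ℕ
[ b ]ₙ = if b then 1 else 0

sumTo : ℕ → (ℕ → ℕ) → ℕ
sumTo zero    f = 0
sumTo (suc n) f = sumTo n f ℕ.+ f (suc n)

-- pdoB m n : number of partitions of n into distinct odd parts, all parts ≤ m.
-- Recursion on the largest allowed part size j = suc m: either j does not
-- occur, or (only possible if j is odd and j ≤ n) it occurs exactly once.
pdoB : ℕ → ℕ → ℕ
pdoB zero    n = [ does (n ℕ.≟ 0) ]ₙ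
pdoB (suc m) n =
  pdoB m n ℕ.+ (if odd? (suc m) ∧ does (suc m ≤? n) then pdoB m (n ∸ suc m) else 0)

pdo : ℕ → ℕ
pdo n = pdoB n n

-- opoB m n : number of overpartitions of n into odd parts, all parts ≤ m.
-- Recursion on the largest allowed part size j = suc m: either j does not
-- occur, or (only if j is odd) it occurs with some multiplicity c ≥ 1,
-- c * j ≤ n, and then there are 2 choices (first occurrence overlined or not).
opoB : ℕ → ℕ → ℕ
opoB zero    n = [ does (n ℕ.≟ 0) ]ₙ
opoB (suc m) n =
  opoB m n ℕ.+
  (if odd? (suc m)
   then sumTo n (λ c → if does (c ℕ.* suc m ≤? n) then 2 ℕ.* opoB m (n ∸ c ℕ.* suc m) else 0)
   else 0)

opo : ℕ → ℕ
opo n = opoB n n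

extℤ : (ℕ → ℕ) → ℤ → ℤ
extℤ f (+ n)    = + f n
extℤ f -[1+ n ] = + 0

symSum : ℕ → (ℤ → ℤ) → ℤ
symSum zero    g = g (+ 0)
symSum (suc N) g = symSum N g ℤ.+ g (+ suc N) ℤ.+ g -[1+ N ]

sign : ℤ → ℤ
sign (+ zero)          = + 1
sign (+ suc zero)      = ℤ.- (+ 1)
sign (+ suc (suc k))   = sign (+ k)
sign -[1+ zero ]       = ℤ.- (+ 1)
sign -[1+ suc zero ]   = + 1
sign -[1+ suc (suc k) ] = sign -[1+ k ]

-- the pentagonal-type number k(3k+1)/2 (k(3k+1) is always a nonnegative even integer)
pent : ℤ → ℤ
pent k = + (∣ k ℤ.* (+ 3 ℤ.* k ℤ.+ + 1) ∣ / 2)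

lhsSum : ℕ → ℕ → ℤ
lhsSum N n = symSum N (λ k → sign k ℤ.* extℤ opo (+ n ℤ.- pent k))

rhsSum : ℕ → ℕ → ℤ
rhsSum N n = symSum N (λ k → sign k ℤ.* extℤ pdo (+ n ℤ.- k ℤ.* (+ 3 ℤ.* k ℤ.+ + 1)))

{-# OPTIONS --safe #-}

-- Read f : ℤ → ℤ as the series Σ f(j) qʲ.  Shanks' finite form of Euler's pentagonal theorem,
--   Σ_{k=0}^{N} (−1)ᵏ q^{Nk + k(k+1)/2} (q;q)_N / (q;q)_k = Σ_{|k|≤N} (−1)ᵏ q^{k(3k+1)/2},
-- identifies, for n ≤ N, the left side with the coefficient of qⁿ in (q;q)_N · Σ p̄_o(m) qᵐ and the
-- right side with that of (q²;q²)_N · Σ p_do(m) qᵐ.  Factors 1 − qⁱ with i > n do not affect the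
-- coefficient of qⁿ, so (q;q)_N may be replaced by (q;q)_{2N} = (q;q²)_N (q²;q²)_N.  With P̄_j and D_j
-- the generating functions restricted to parts ≤ j, for odd j one has (1 − qʲ) P̄_j = (1 + qʲ) P̄_{j−1}
-- and D_j = (1 + qʲ) D_{j−1}; hence (q;q²)_N P̄_{2N} = D_{2N}, and below degree 2N + 1 the restricted
-- series agree with the full ones.

module Submission where

open import Defs
open import Data.Nat using (ℕ; _≤_)
open import Relation.Binary.PropositionalEquality using (_≡_)
open import Data.Bool using (true; false; if_then_else_)
open import Data.Bool.Properties using (∧-zeroʳ)
open import Data.Integer as ℤ using (ℤ; +_; -[1+_]; _+_; _-_; _*_; -_; +≤+)
import Data.Integer.Properties as ℤ
import Data.Integer.Tactic.RingSolver as ℤ-Solver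
open import Data.Nat as ℕ using (zero; suc; _∸_; _<_; _≤?_; _≤′_; ≤′-refl; ≤′-step; z≤n; s≤s)
import Data.Nat.Properties as ℕ
import Data.Nat.Tactic.RingSolver as ℕ-Solver
open import Data.Nat.DivMod using (_/_; m*n/n≡m)
open import Data.Product using (_,_)
open import Function using (_∘_)
open import Relation.Binary.PropositionalEquality
open import Relation.Nullary using (yes; no)
open import Relation.Nullary.Decidable using (does; map′; does-≡; dec-true; dec-false)
import Relation.Binary.Reasoning.Setoid as SetoidReasoning

Series : Set
Series = ℤ → ℤ

module ≗-Reasoning = SetoidReasoning (ℤ →-setoid ℤ)

infixr 6 1-q^_·_ 1+q^_·_

1-q^_·_ : ℕ → Series → Series
(1-q^ i · f) j = f j - f (j - + i)

1+q^_·_ : ℕ → Series → Series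
(1+q^ i · f) j = f j + f (j - + i)

1-q^-cong : ∀ i {f g} → f ≗ g → 1-q^ i · f ≗ 1-q^ i · g
1-q^-cong i f≗g j = cong₂ _-_ (f≗g j) (f≗g (j - + i))

1+q^-cong : ∀ i {f g} → f ≗ g → 1+q^ i · f ≗ 1+q^ i · g
1+q^-cong i f≗g j = cong₂ _+_ (f≗g j) (f≗g (j - + i))

1-q^-exponent : ∀ {i k} → i ≡ k → ∀ f → 1-q^ i · f ≗ 1-q^ k · f
1-q^-exponent refl f j = refl

private
  sub-comm : ∀ j a b → j - a - b ≡ j - b - a
  sub-comm = ℤ-Solver.solve-∀

1-q^-comm : ∀ i k f → 1-q^ i · 1-q^ k · f ≗ 1-q^ k · 1-q^ i · f
1-q^-comm i k f j rewrite sub-comm j (+ i) (+ k) =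
  interchange (f j) (f (j - + k)) (f (j - + i)) (f (j - + k - + i))
  where
  interchange : ∀ a b c d → (a - b) - (c - d) ≡ (a - c) - (b - d)
  interchange = ℤ-Solver.solve-∀

1+q^-1-q^-comm : ∀ i k f → 1+q^ i · 1-q^ k · f ≗ 1-q^ k · 1+q^ i · f
1+q^-1-q^-comm i k f j rewrite sub-comm j (+ i) (+ k) =
  interchange (f j) (f (j - + k)) (f (j - + i)) (f (j - + k - + i))
  where
  interchange : ∀ a b c d → (a - b) + (c - d) ≡ (a + c) - (b + d)
  interchange = ℤ-Solver.solve-∀

-- qPoch d a b f = (q^{d(a+1)}; q^d)_b · f
qPoch : ℕ → ℕ → ℕ → Series → Series
qPoch d a zero    f = f
qPoch d a (suc b) f = 1-q^ (d ℕ.* (a ℕ.+ suc b)) · qPoch d a b f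

qPoch-cong : ∀ d a b {f g} → f ≗ g → qPoch d a b f ≗ qPoch d a b g
qPoch-cong d a zero    f≗g = f≗g
qPoch-cong d a (suc b) f≗g = 1-q^-cong _ (qPoch-cong d a b f≗g)

qPoch-sucˡ : ∀ d a b f → qPoch d a (suc b) f ≗ 1-q^ (d ℕ.* suc a) · qPoch d (suc a) b f
qPoch-sucˡ d a zero    f = 1-q^-exponent (cong (d ℕ.*_) (ℕ.+-comm a 1)) f
qPoch-sucˡ d a (suc b) f = begin
  1-q^ (d ℕ.* (a ℕ.+ suc (suc b))) · qPoch d a (suc b) f
    ≈⟨ 1-q^-cong _ (qPoch-sucˡ d a b f) ⟩
  1-q^ (d ℕ.* (a ℕ.+ suc (suc b))) · 1-q^ (d ℕ.* suc a) · qPoch d (suc a) b f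
    ≈⟨ 1-q^-comm _ _ (qPoch d (suc a) b f) ⟩
  1-q^ (d ℕ.* suc a) · 1-q^ (d ℕ.* (a ℕ.+ suc (suc b))) · qPoch d (suc a) b f
    ≈⟨ 1-q^-cong _ (1-q^-exponent (cong (d ℕ.*_) (ℕ.+-suc a (suc b))) (qPoch d (suc a) b f)) ⟩
  1-q^ (d ℕ.* suc a) · qPoch d (suc a) (suc b) f
    ∎
  where open ≗-Reasoning

oddPoch : ℕ → Series → Series
oddPoch zero    f = f
oddPoch (suc m) f = if odd? (suc m) then 1-q^ suc m · oddPoch m f else oddPoch m f

oddPoch-cong : ∀ m {f g} → f ≗ g → oddPoch m f ≗ oddPoch m g
oddPoch-cong zero    f≗g = f≗g
oddPoch-cong (suc m) f≗g with odd? (suc m)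
... | true  = 1-q^-cong _ (oddPoch-cong m f≗g)
... | false = oddPoch-cong m f≗g

module Commuting (Φ : Series → Series) (Φ-1-q^ : ∀ k f → Φ (1-q^ k · f) ≗ 1-q^ k · Φ f) where

  qPoch-comm : ∀ d a b f → Φ (qPoch d a b f) ≗ qPoch d a b (Φ f)
  qPoch-comm d a zero    f j = refl
  qPoch-comm d a (suc b) f j = trans (Φ-1-q^ _ _ j) (1-q^-cong _ (qPoch-comm d a b f) j)

  oddPoch-comm : ∀ m f → Φ (oddPoch m f) ≗ oddPoch m (Φ f)
  oddPoch-comm zero    f j = refl
  oddPoch-comm (suc m) f with odd? (suc m)
  ... | true  = λ j → trans (Φ-1-q^ _ _ j) (1-q^-cong _ (oddPoch-comm m f) j)
  ... | false = oddPoch-comm m f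

1-q^-qPoch-comm : ∀ i d a b f → 1-q^ i · qPoch d a b f ≗ qPoch d a b (1-q^ i · f)
1-q^-qPoch-comm i = Commuting.qPoch-comm (1-q^ i ·_) (1-q^-comm i)

1-q^-oddPoch-comm : ∀ i m f → 1-q^ i · oddPoch m f ≗ oddPoch m (1-q^ i · f)
1-q^-oddPoch-comm i = Commuting.oddPoch-comm (1-q^ i ·_) (1-q^-comm i)

1+q^-oddPoch-comm : ∀ i m f → 1+q^ i · oddPoch m f ≗ oddPoch m (1+q^ i · f)
1+q^-oddPoch-comm i = Commuting.oddPoch-comm (1+q^ i ·_) (1+q^-1-q^-comm i)

-- Power series and coefficients of low degree

record IsPowerSeries (f : Series) : Set where
  field vanish : ∀ t → f -[1+ t ] ≡ + 0
open IsPowerSeries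

isPowerSeries-ext : ∀ {f g} → IsPowerSeries f → IsPowerSeries g →
                    (∀ n → f (+ n) ≡ g (+ n)) → f ≗ g
isPowerSeries-ext f-ps g-ps f≡g (+ n)    = f≡g n
isPowerSeries-ext f-ps g-ps f≡g -[1+ t ] = trans (vanish f-ps t) (sym (vanish g-ps t))

isPowerSeries-sub : ∀ {f} → IsPowerSeries f → ∀ t i → f (-[1+ t ] - + i) ≡ + 0
isPowerSeries-sub {f} f-ps t zero    = trans (cong f (ℤ.+-identityʳ _)) (vanish f-ps t)
isPowerSeries-sub     f-ps t (suc i) = vanish f-ps (suc (t ℕ.+ i))

isPowerSeries-below : ∀ {f} → IsPowerSeries f → ∀ {n i} → n < i → f (+ n - + i) ≡ + 0
isPowerSeries-below {f} f-ps {n} {suc i} (s≤s n≤i) = begin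
  f (+ n - + suc i)   ≡⟨ cong f (trans (ℤ.m-n≡m⊖n n (suc i)) (ℤ.⊖-< (s≤s n≤i))) ⟩
  f (- + (suc i ∸ n)) ≡⟨ cong (f ∘ -_ ∘ +_) (ℕ.+-∸-assoc 1 n≤i) ⟩
  f -[1+ i ∸ n ]      ≡⟨ vanish f-ps (i ∸ n) ⟩
  + 0                 ∎
  where open ≡-Reasoning

extℤ-isPowerSeries : ∀ F → IsPowerSeries (extℤ F)
extℤ-isPowerSeries F = record { vanish = λ _ → refl }

1-q^-isPowerSeries : ∀ i {f} → IsPowerSeries f → IsPowerSeries (1-q^ i · f)
vanish (1-q^-isPowerSeries i f-ps) t rewrite vanish f-ps t | isPowerSeries-sub f-ps t i = refl

1+q^-isPowerSeries : ∀ i {f} → IsPowerSeries f → IsPowerSeries (1+q^ i · f)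
vanish (1+q^-isPowerSeries i f-ps) t rewrite vanish f-ps t | isPowerSeries-sub f-ps t i = refl

qPoch-isPowerSeries : ∀ d a b {f} → IsPowerSeries f → IsPowerSeries (qPoch d a b f)
qPoch-isPowerSeries d a zero    f-ps = f-ps
qPoch-isPowerSeries d a (suc b) f-ps = 1-q^-isPowerSeries _ (qPoch-isPowerSeries d a b f-ps)

1-q^-below : ∀ {f} → IsPowerSeries f → ∀ {n i} → n < i → (1-q^ i · f) (+ n) ≡ f (+ n)
1-q^-below {f} f-ps {n} n<i =
  trans (cong (λ x → f (+ n) - x) (isPowerSeries-below f-ps n<i)) (ℤ.+-identityʳ _)

qPoch-stable : ∀ d {f} → IsPowerSeries f → ∀ {n M K} → n ≤ M → M ≤′ K →
               qPoch (suc d) 0 K f (+ n) ≡ qPoch (suc d) 0 M f (+ n)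
qPoch-stable d f-ps n≤M ≤′-refl = refl
qPoch-stable d f-ps {n} {M} n≤M (≤′-step {K} M≤′K) =
  trans (1-q^-below (qPoch-isPowerSeries _ 0 K f-ps) n<d[1+K])
        (qPoch-stable d f-ps n≤M M≤′K)
  where
  n<d[1+K] : n < suc d ℕ.* suc K
  n<d[1+K] = ℕ.≤-trans (s≤s (ℕ.≤-trans n≤M (ℕ.≤′⇒≤ M≤′K))) (ℕ.m≤n*m (suc K) (suc d))

AgreeUpTo : ℕ → Series → Series → Set
AgreeUpTo n f g = ∀ {j} → j ℤ.≤ + n → f j ≡ g j

1-q^-agree : ∀ i {n f g} → AgreeUpTo n f g → AgreeUpTo n (1-q^ i · f) (1-q^ i · g)
1-q^-agree i f≈g j≤n = cong₂ _-_ (f≈g j≤n) (f≈g (ℤ.i≤j⇒i-k≤j (+ i) j≤n))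

qPoch-agree : ∀ d a b {n f g} → AgreeUpTo n f g → AgreeUpTo n (qPoch d a b f) (qPoch d a b g)
qPoch-agree d a zero    f≈g = f≈g
qPoch-agree d a (suc b) f≈g = 1-q^-agree _ (qPoch-agree d a b f≈g)

extℤ-agree : ∀ {n F G} → (∀ {m} → m ≤ n → F m ≡ G m) → AgreeUpTo n (extℤ F) (extℤ G)
extℤ-agree F≡G { -[1+ t ]} _          = refl
extℤ-agree F≡G {+ m}       (+≤+ m≤n) = cong +_ (F≡G m≤n)

-- Pentagonal numbers and Shanks' identity

sign-suc : ∀ k → sign (+ suc k) ≡ - sign (+ k)
sign-suc zero          = refl
sign-suc (suc zero)    = refl
sign-suc (suc (suc k)) = sign-suc k

sign-neg : ∀ m → sign -[1+ m ] ≡ sign (+ suc m)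
sign-neg zero          = refl
sign-neg (suc zero)    = refl
sign-neg (suc (suc m)) = sign-neg m

tri : ℕ → ℕ
tri zero    = 0
tri (suc k) = tri k ℕ.+ suc k

pentagonal : ℤ → ℕ
pentagonal (+ n)    = n ℕ.* n ℕ.+ tri n
pentagonal -[1+ m ] = suc m ℕ.* suc m ℕ.+ tri m

2*tri≡n*[1+n] : ∀ n → 2 ℕ.* tri n ≡ n ℕ.* suc n
2*tri≡n*[1+n] zero    = refl
2*tri≡n*[1+n] (suc n) = begin
  2 ℕ.* (tri n ℕ.+ suc n)          ≡⟨ ℕ.*-distribˡ-+ 2 (tri n) (suc n) ⟩
  2 ℕ.* tri n ℕ.+ 2 ℕ.* suc n      ≡⟨ cong (ℕ._+ 2 ℕ.* suc n) (2*tri≡n*[1+n] n) ⟩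
  n ℕ.* suc n ℕ.+ 2 ℕ.* suc n      ≡⟨ factor n ⟩
  suc n ℕ.* suc (suc n)            ∎
  where
  open ≡-Reasoning
  factor : ∀ n → n ℕ.* suc n ℕ.+ 2 ℕ.* suc n ≡ suc n ℕ.* suc (suc n)
  factor = ℕ-Solver.solve-∀

2*pentagonal-pos : ∀ n → 2 ℕ.* pentagonal (+ n) ≡ n ℕ.* (3 ℕ.* n ℕ.+ 1)
2*pentagonal-pos n =
  trans (ℕ.*-distribˡ-+ 2 (n ℕ.* n) (tri n))
        (trans (cong (2 ℕ.* (n ℕ.* n) ℕ.+_) (2*tri≡n*[1+n] n)) (factor n))
  where
  factor : ∀ n → 2 ℕ.* (n ℕ.* n) ℕ.+ n ℕ.* suc n ≡ n ℕ.* (3 ℕ.* n ℕ.+ 1)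
  factor = ℕ-Solver.solve-∀

2*pentagonal-neg : ∀ m → 2 ℕ.* pentagonal -[1+ m ] ≡ suc m ℕ.* (3 ℕ.* m ℕ.+ 2)
2*pentagonal-neg m =
  trans (ℕ.*-distribˡ-+ 2 (suc m ℕ.* suc m) (tri m))
        (trans (cong (2 ℕ.* (suc m ℕ.* suc m) ℕ.+_) (2*tri≡n*[1+n] m)) (factor m))
  where
  factor : ∀ m → 2 ℕ.* (suc m ℕ.* suc m) ℕ.+ m ℕ.* suc m ≡ suc m ℕ.* (3 ℕ.* m ℕ.+ 2)
  factor = ℕ-Solver.solve-∀

pos-affine : ∀ a n b → + a * + n + + b ≡ + (a ℕ.* n ℕ.+ b)
pos-affine a n b = trans (cong (_+ + b) (sym (ℤ.pos-* a n))) (sym (ℤ.pos-+ (a ℕ.* n) b))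

k[3k+1]≡2*pentagonal : ∀ k → k * (+ 3 * k + + 1) ≡ + (2 ℕ.* pentagonal k)
k[3k+1]≡2*pentagonal (+ n) =
  trans (cong (+ n *_) (pos-affine 3 n 1))
        (trans (sym (ℤ.pos-* n _)) (cong +_ (sym (2*pentagonal-pos n))))
k[3k+1]≡2*pentagonal -[1+ m ] =
  trans (negate (+ m))
        (trans (cong (+ suc m *_) (pos-affine 3 m 2))
               (trans (sym (ℤ.pos-* (suc m) _)) (cong +_ (sym (2*pentagonal-neg m)))))
  where
  negate : ∀ x → (- (+ 1 + x)) * (+ 3 * (- (+ 1 + x)) + + 1) ≡ (+ 1 + x) * (+ 3 * x + + 2)
  negate = ℤ-Solver.solve-∀

pent≡pentagonal : ∀ k → pent k ≡ + pentagonal k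
pent≡pentagonal k =
  trans (cong (λ x → + (ℤ.∣ x ∣ / 2)) (k[3k+1]≡2*pentagonal k))
        (cong +_ (trans (cong (_/ 2) (ℕ.*-comm 2 (pentagonal k))) (m*n/n≡m (pentagonal k) 2)))

Σ≤ : ℕ → (ℕ → ℤ) → ℤ
Σ≤ zero    h = h 0
Σ≤ (suc n) h = Σ≤ n h + h (suc n)

Σ≤-telescope : ∀ m {a b g : ℕ → ℤ} → (∀ {k} → k ≤ m → a k ≡ b k + g (suc k) - g k) →
               Σ≤ m a ≡ Σ≤ m b + g (suc m) - g 0
Σ≤-telescope zero    step = step z≤n
Σ≤-telescope (suc m) {a} {b} {g} step = begin
  Σ≤ m a + a (suc m)
    ≡⟨ cong₂ _+_ (Σ≤-telescope m (λ k≤m → step (ℕ.m≤n⇒m≤1+n k≤m))) (step ℕ.≤-refl) ⟩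
  (Σ≤ m b + g (suc m) - g 0) + (b (suc m) + g (suc (suc m)) - g (suc m))
    ≡⟨ collapse (Σ≤ m b) (b (suc m)) (g 0) (g (suc m)) (g (suc (suc m))) ⟩
  Σ≤ m b + b (suc m) + g (suc (suc m)) - g 0
    ∎
  where
  open ≡-Reasoning
  collapse : ∀ B x g₀ g₁ g₂ → (B + g₁ - g₀) + (x + g₂ - g₁) ≡ B + x + g₂ - g₀
  collapse = ℤ-Solver.solve-∀

Σ≤-head : ∀ N {h : ℕ → ℤ} → (∀ k → h (suc k) ≡ + 0) → Σ≤ N h ≡ h 0
Σ≤-head zero    tail = refl
Σ≤-head (suc N) tail = trans (cong₂ _+_ (Σ≤-head N tail) (tail N)) (ℤ.+-identityʳ _)

sub-+ : ∀ j a b → j - + (a ℕ.+ b) ≡ j - + a - + b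
sub-+ j a b = trans (cong (λ x → j - x) (ℤ.pos-+ a b)) (distrib j (+ a) (+ b))
  where
  distrib : ∀ j x y → j - (x + y) ≡ j - x - y
  distrib = ℤ-Solver.solve-∀

suc-+-∸ : ∀ k r → suc (k ℕ.+ r) ∸ k ≡ suc r
suc-+-∸ k r = trans (cong (_∸ k) (sym (ℕ.+-suc k r))) (ℕ.m+n∸m≡n k (suc r))

private
  exponent-summand : ∀ d k r t →
    d ℕ.* (suc (k ℕ.+ r) ℕ.* k ℕ.+ t) ≡ d ℕ.* ((k ℕ.+ r) ℕ.* k ℕ.+ t) ℕ.+ d ℕ.* k
  exponent-summand = ℕ-Solver.solve-∀

  exponent-upper : ∀ d k r t →
    d ℕ.* (suc (k ℕ.+ r) ℕ.* suc k ℕ.+ t) ≡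
    d ℕ.* ((k ℕ.+ r) ℕ.* k ℕ.+ t) ℕ.+ d ℕ.* k ℕ.+ d ℕ.* (k ℕ.+ suc r)
  exponent-upper = ℕ-Solver.solve-∀

  exponent-lower : ∀ d k r t →
    d ℕ.* (suc (suc k ℕ.+ r) ℕ.* suc k ℕ.+ t) ≡ d ℕ.* ((suc k ℕ.+ r) ℕ.* suc k ℕ.+ (t ℕ.+ suc k))
  exponent-lower = ℕ-Solver.solve-∀

module Shanks (d : ℕ) (f : Series) where

  -- (−1)ᵏ q^{d(nk + k(k+1)/2)} (q^d; q^d)_n / (q^d; q^d)_k · f
  summand : ℕ → ℕ → Series
  summand n k j = sign (+ k) * qPoch d k (n ∸ k) f (j - + (d ℕ.* (n ℕ.* k ℕ.+ tri k)))

  -- (−1)ᵏ q^{d(nk + k(k−1)/2)} (q^d; q^d)_{n−1} / (q^d; q^d)_{k−1} · f, for k ≥ 1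
  correction : ℕ → ℕ → Series
  correction n zero    j = + 0
  correction n (suc k) j =
    sign (+ suc k) * qPoch d k (n ∸ suc k) f (j - + (d ℕ.* (n ℕ.* suc k ℕ.+ tri k)))

  correction-lower : ∀ k r j → let j₀ = j - + (d ℕ.* ((k ℕ.+ r) ℕ.* k ℕ.+ tri k)) in
    correction (suc (k ℕ.+ r)) k j ≡ sign (+ k) * (qPoch d k r f j₀ - qPoch d k r f (j₀ - + (d ℕ.* k)))
  correction-lower zero r j = begin
    + 0                                       ≡⟨ ℤ.*-zeroʳ (+ 1) ⟨
    + 1 * + 0                                 ≡⟨ cong (+ 1 *_) (ℤ.+-inverseʳ (P j₀)) ⟨
    + 1 * (P j₀ - P j₀)                       ≡⟨ cong (λ x → + 1 * (P j₀ - P x)) j₀-0 ⟨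
    + 1 * (P j₀ - P (j₀ - + (d ℕ.* 0)))       ∎
    where
    open ≡-Reasoning
    P = qPoch d 0 r f
    j₀ = j - + (d ℕ.* ((0 ℕ.+ r) ℕ.* 0 ℕ.+ 0))
    j₀-0 : j₀ - + (d ℕ.* 0) ≡ j₀
    j₀-0 = trans (cong (λ e → j₀ - + e) (ℕ.*-zeroʳ d)) (ℤ.+-identityʳ j₀)
  correction-lower (suc k) r j =
    cong (sign (+ suc k) *_)
      (trans (cong₂ (λ b x → qPoch d k b f x) (suc-+-∸ k r)
                    (cong (λ e → j - + e) (exponent-lower d k r (tri k))))
             (qPoch-sucˡ d k r f _))

  summand-step : ∀ k r j →
    summand (suc (k ℕ.+ r)) k j ≡
    summand (k ℕ.+ r) k j + correction (suc (k ℕ.+ r)) (suc k) j - correction (suc (k ℕ.+ r)) k j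
  summand-step k r j = begin
    summand (suc (k ℕ.+ r)) k j                         ≡⟨ current ⟩
    s * (P j₁ - P j₂)                                   ≡⟨ regroup s (P j₀) (P j₁) (P j₂) ⟩
    s * P j₀ + (- s) * P j₂ - s * (P j₀ - P j₁)         ≡⟨ cong₂ _-_ (cong₂ _+_ previous upper)
                                                                      (correction-lower k r j) ⟨
    summand (k ℕ.+ r) k j + correction (suc (k ℕ.+ r)) (suc k) j - correction (suc (k ℕ.+ r)) k j
                                                        ∎
    where
    open ≡-Reasoning
    s = sign (+ k)
    P = qPoch d k r f
    t = tri k
    j₀ = j - + (d ℕ.* ((k ℕ.+ r) ℕ.* k ℕ.+ t))
    j₁ = j₀ - + (d ℕ.* k)
    j₂ = j₁ - + (d ℕ.* (k ℕ.+ suc r))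
    regroup : ∀ s x₀ x₁ x₂ → s * (x₁ - x₂) ≡ s * x₀ + (- s) * x₂ - s * (x₀ - x₁)
    regroup = ℤ-Solver.solve-∀
    current : summand (suc (k ℕ.+ r)) k j ≡ s * (P j₁ - P j₂)
    current = cong₂ (λ b x → s * qPoch d k b f x) (suc-+-∸ k r)
                (trans (cong (λ e → j - + e) (exponent-summand d k r t)) (sub-+ j _ _))
    previous : summand (k ℕ.+ r) k j ≡ s * P j₀
    previous = cong (λ b → s * qPoch d k b f j₀) (ℕ.m+n∸m≡n k r)
    upper : correction (suc (k ℕ.+ r)) (suc k) j ≡ (- s) * P j₂
    upper = cong₂ _*_ (sign-suc k)
              (cong₂ (λ b x → qPoch d k b f x) (ℕ.m+n∸m≡n k r)
                (trans (cong (λ e → j - + e) (exponent-upper d k r t))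
                       (trans (sub-+ j _ _) (cong (_- + (d ℕ.* (k ℕ.+ suc r))) (sub-+ j _ _)))))

  shanks : ∀ n j → Σ≤ n (λ k → summand n k j) ≡ symSum n (λ k → sign k * f (j - + (d ℕ.* pentagonal k)))
  shanks zero    j = refl
  shanks (suc m) j = begin
    Σ≤ m (λ k → summand (suc m) k j) + summand (suc m) (suc m) j
      ≡⟨ cong (_+ summand (suc m) (suc m) j) (Σ≤-telescope m step) ⟩
    (Σ≤ m (λ k → summand m k j) + correction (suc m) (suc m) j - + 0) + summand (suc m) (suc m) j
      ≡⟨ cong₂ (λ x y → (x + y - + 0) + summand (suc m) (suc m) j) (shanks m j) last-correction ⟩
    (symSum m g + g -[1+ m ] - + 0) + summand (suc m) (suc m) j
      ≡⟨ cong (λ y → (symSum m g + g -[1+ m ] - + 0) + y) last-summand ⟩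
    (symSum m g + g -[1+ m ] - + 0) + g (+ suc m)
      ≡⟨ regroup (symSum m g) (g -[1+ m ]) (g (+ suc m)) ⟩
    symSum m g + g (+ suc m) + g -[1+ m ]
      ∎
    where
    open ≡-Reasoning
    g : ℤ → ℤ
    g k = sign k * f (j - + (d ℕ.* pentagonal k))
    step : ∀ {k} → k ≤ m →
           summand (suc m) k j ≡ summand m k j + correction (suc m) (suc k) j - correction (suc m) k j
    step {k} k≤m =
      subst (λ n → summand (suc n) k j ≡
                   summand n k j + correction (suc n) (suc k) j - correction (suc n) k j)
            (ℕ.m+[n∸m]≡n k≤m) (summand-step k (m ∸ k) j)
    last-correction : correction (suc m) (suc m) j ≡ g -[1+ m ]
    last-correction = cong₂ (λ s b → s * qPoch d m b f (j - + (d ℕ.* pentagonal -[1+ m ])))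
                            (sym (sign-neg m)) (ℕ.n∸n≡0 m)
    last-summand : summand (suc m) (suc m) j ≡ g (+ suc m)
    last-summand = cong (λ b → sign (+ suc m) * qPoch d (suc m) b f (j - + (d ℕ.* pentagonal (+ suc m))))
                        (ℕ.n∸n≡0 m)
    regroup : ∀ S x y → (S + x - + 0) + y ≡ S + y + x
    regroup = ℤ-Solver.solve-∀

  summand-zero : ∀ N j → summand N 0 j ≡ qPoch d 0 N f j
  summand-zero N j = trans (ℤ.*-identityˡ _) (cong (qPoch d 0 N f) j-0)
    where
    j-0 : j - + (d ℕ.* (N ℕ.* 0 ℕ.+ 0)) ≡ j
    j-0 = trans (cong (λ e → j - + (d ℕ.* e)) (trans (ℕ.+-identityʳ _) (ℕ.*-zeroʳ N)))
                (trans (cong (λ e → j - + e) (ℕ.*-zeroʳ d)) (ℤ.+-identityʳ j))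

pentagonal-theorem : ∀ d {f} → IsPowerSeries f → ∀ {n N} → n ≤ N →
  symSum N (λ k → sign k * f (+ n - + (suc d ℕ.* pentagonal k))) ≡ qPoch (suc d) 0 N f (+ n)
pentagonal-theorem d {f} f-ps {n} {N} n≤N = begin
  symSum N (λ k → sign k * f (+ n - + (suc d ℕ.* pentagonal k)))  ≡⟨ shanks N (+ n) ⟨
  Σ≤ N (λ k → summand N k (+ n))                                  ≡⟨ Σ≤-head N summand-suc ⟩
  summand N 0 (+ n)                                               ≡⟨ summand-zero N (+ n) ⟩
  qPoch (suc d) 0 N f (+ n)                                       ∎
  where
  open Shanks (suc d) f
  open ≡-Reasoning
  summand-suc : ∀ k → summand N (suc k) (+ n) ≡ + 0
  summand-suc k =
    trans (cong (sign (+ suc k) *_)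
                (isPowerSeries-below (qPoch-isPowerSeries _ (suc k) (N ∸ suc k) f-ps) n<e))
          (ℤ.*-zeroʳ (sign (+ suc k)))
    where
    n<e : n < suc d ℕ.* (N ℕ.* suc k ℕ.+ tri (suc k))
    n<e = ℕ.≤-trans (ℕ.≤-<-trans (ℕ.≤-trans n≤N (ℕ.m≤m*n N (suc k)))
                                 (ℕ.m<m+n _ (ℕ.<-≤-trans ℕ.z<s (ℕ.m≤n+m (suc k) (tri k)))))
                    (ℕ.m≤n*m _ (suc d))

symSum-cong : ∀ N {g h : ℤ → ℤ} → g ≗ h → symSum N g ≡ symSum N h
symSum-cong zero    g≗h = g≗h (+ 0)
symSum-cong (suc N) g≗h = cong₂ _+_ (cong₂ _+_ (symSum-cong N g≗h) (g≗h (+ suc N))) (g≗h -[1+ N ])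

lhsSum≡coefficient : ∀ {n N} → n ≤ N → lhsSum N n ≡ qPoch 1 0 N (extℤ opo) (+ n)
lhsSum≡coefficient {n} {N} n≤N =
  trans (symSum-cong N (λ k → cong (λ e → sign k * extℤ opo (+ n - e))
                                   (trans (pent≡pentagonal k) (cong +_ (sym (ℕ.*-identityˡ _))))))
        (pentagonal-theorem 0 (extℤ-isPowerSeries opo) n≤N)

rhsSum≡coefficient : ∀ {n N} → n ≤ N → rhsSum N n ≡ qPoch 2 0 N (extℤ pdo) (+ n)
rhsSum≡coefficient {n} {N} n≤N =
  trans (symSum-cong N (λ k → cong (λ e → sign k * extℤ pdo (+ n - e)) (k[3k+1]≡2*pentagonal k)))
        (pentagonal-theorem 1 (extℤ-isPowerSeries pdo) n≤N)

-- (q;q)_{2N} = (q;q²)_N (q²;q²)_N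

double : ℕ → ℕ
double zero    = zero
double (suc n) = suc (suc (double n))

≤-double : ∀ n → n ≤ double n
≤-double zero    = z≤n
≤-double (suc n) = s≤s (ℕ.m≤n⇒m≤1+n (≤-double n))

2*-double : ∀ n → 2 ℕ.* n ≡ double n
2*-double zero    = refl
2*-double (suc n) = trans (two-suc n) (cong (suc ∘ suc) (2*-double n))
  where
  two-suc : ∀ n → 2 ℕ.* suc n ≡ suc (suc (2 ℕ.* n))
  two-suc = ℕ-Solver.solve-∀

odd?-double : ∀ n → odd? (double n) ≡ false
odd?-double zero    = refl
odd?-double (suc n) = odd?-double n

odd?-suc-double : ∀ n → odd? (suc (double n)) ≡ true
odd?-suc-double zero    = refl
odd?-suc-double (suc n) = odd?-suc-double n

oddPoch-double : ∀ n g → oddPoch (double (suc n)) g ≡ 1-q^ suc (double n) · oddPoch (double n) g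
oddPoch-double n g rewrite odd?-double n | odd?-suc-double n = refl

qPoch-split : ∀ N g → qPoch 1 0 (double N) g ≗ qPoch 2 0 N (oddPoch (double N) g)
qPoch-split zero    g = λ _ → refl
qPoch-split (suc N) g = begin
  1-q^ (1 ℕ.* suc (suc dN)) · 1-q^ (1 ℕ.* suc dN) · qPoch 1 0 dN g
    ≈⟨ 1-q^-exponent (ℕ.*-identityˡ _) (1-q^ (1 ℕ.* suc dN) · qPoch 1 0 dN g) ⟩
  1-q^ suc (suc dN) · 1-q^ (1 ℕ.* suc dN) · qPoch 1 0 dN g
    ≈⟨ 1-q^-cong _ (1-q^-exponent (ℕ.*-identityˡ _) (qPoch 1 0 dN g)) ⟩
  1-q^ suc (suc dN) · 1-q^ suc dN · qPoch 1 0 dN g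
    ≈⟨ 1-q^-cong _ (1-q^-cong _ (qPoch-split N g)) ⟩
  1-q^ suc (suc dN) · 1-q^ suc dN · qPoch 2 0 N (oddPoch dN g)
    ≈⟨ 1-q^-cong _ (1-q^-qPoch-comm (suc dN) 2 0 N (oddPoch dN g)) ⟩
  1-q^ suc (suc dN) · qPoch 2 0 N (1-q^ suc dN · oddPoch dN g)
    ≡⟨ cong (λ h → 1-q^ suc (suc dN) · qPoch 2 0 N h) (oddPoch-double N g) ⟨
  1-q^ suc (suc dN) · qPoch 2 0 N (oddPoch (double (suc N)) g)
    ≈⟨ 1-q^-exponent (2*-double (suc N)) (qPoch 2 0 N (oddPoch (double (suc N)) g)) ⟨
  qPoch 2 0 (suc N) (oddPoch (double (suc N)) g)
    ∎
  where
  open ≗-Reasoning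
  dN = double N

-- Overpartitions into odd parts and partitions into distinct odd parts

sumTo-cong : ∀ K {h h′ : ℕ → ℕ} → (∀ c → h c ≡ h′ c) → sumTo K h ≡ sumTo K h′
sumTo-cong zero    h≡h′ = refl
sumTo-cong (suc K) h≡h′ = cong₂ ℕ._+_ (sumTo-cong K h≡h′) (h≡h′ (suc K))

sumTo-suc : ∀ K h → sumTo (suc K) h ≡ h 1 ℕ.+ sumTo K (h ∘ suc)
sumTo-suc zero    h = ℕ.+-comm 0 (h 1)
sumTo-suc (suc K) h = trans (cong (ℕ._+ h (suc (suc K))) (sumTo-suc K h)) (ℕ.+-assoc (h 1) _ _)

does-+-≤ : ∀ m x y → does (m ℕ.+ x ≤? m ℕ.+ y) ≡ does (x ≤? y)
does-+-≤ m x y = does-≡ (m ℕ.+ x ≤? m ℕ.+ y) (map′ (ℕ.+-monoʳ-≤ m) (ℕ.+-cancelˡ-≤ m x y) (x ≤? y))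

copies : ℕ → ℕ → ℕ → ℕ
copies M n c = if does (c ℕ.* suc M ≤? n) then 2 ℕ.* opoB M (n ∸ c ℕ.* suc M) else 0

copies-large : ∀ M {n c} → n < c ℕ.* suc M → copies M n c ≡ 0
copies-large M {n} {c} n<c[1+M] =
  cong (λ b → if b then 2 ℕ.* opoB M (n ∸ c ℕ.* suc M) else 0)
       (dec-false (c ℕ.* suc M ≤? n) (ℕ.<⇒≱ n<c[1+M]))

sumTo-copies-small : ∀ M K {n} → n < suc M → sumTo K (copies M n) ≡ 0
sumTo-copies-small M zero    n<1+M = refl
sumTo-copies-small M (suc K) n<1+M =
  cong₂ ℕ._+_ (sumTo-copies-small M K n<1+M)
              (copies-large M {c = suc K} (ℕ.<-≤-trans n<1+M (ℕ.m≤m+n (suc M) (K ℕ.* suc M))))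

sumTo-copies-stable : ∀ M {n K} → n ≤′ K → sumTo K (copies M n) ≡ sumTo n (copies M n)
sumTo-copies-stable M ≤′-refl = refl
sumTo-copies-stable M {n} (≤′-step {K} n≤′K) =
  trans (cong₂ ℕ._+_ (sumTo-copies-stable M n≤′K) (copies-large M {c = suc K} n<[1+K][1+M]))
        (ℕ.+-identityʳ _)
  where
  n<[1+K][1+M] : n < suc K ℕ.* suc M
  n<[1+K][1+M] = ℕ.<-≤-trans (s≤s (ℕ.≤′⇒≤ n≤′K)) (ℕ.m≤m*n (suc K) (suc M))

copies-shift : ∀ M r c → copies M (suc M ℕ.+ r) (suc c) ≡ copies M r c
copies-shift M r c =
  cong₂ (λ b x → if b then 2 ℕ.* opoB M x else 0)
        (does-+-≤ (suc M) (c ℕ.* suc M) r) (ℕ.[m+n]∸[m+o]≡n∸o (suc M) r (c ℕ.* suc M))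

sumTo-copies-suc : ∀ M r →
  sumTo (suc M ℕ.+ r) (copies M (suc M ℕ.+ r)) ≡ 2 ℕ.* opoB M r ℕ.+ sumTo r (copies M r)
sumTo-copies-suc M r =
  trans (sumTo-suc (M ℕ.+ r) (copies M (suc M ℕ.+ r)))
        (cong₂ ℕ._+_ (copies-shift M r 0)
                     (trans (sumTo-cong (M ℕ.+ r) (copies-shift M r))
                            (sumTo-copies-stable M (ℕ.≤⇒≤′ (ℕ.m≤n+m r M)))))

opoB-suc-below : ∀ {M n} → n < suc M → opoB (suc M) n ≡ opoB M n
opoB-suc-below {M} {n} n<1+M with odd? (suc M)
... | true  = trans (cong (opoB M n ℕ.+_) (sumTo-copies-small M n n<1+M)) (ℕ.+-identityʳ _)
... | false = ℕ.+-identityʳ _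

opoB-suc-even : ∀ {M n} → odd? (suc M) ≡ false → opoB (suc M) n ≡ opoB M n
opoB-suc-even isEven rewrite isEven = ℕ.+-identityʳ _

opoB-suc-odd : ∀ {M n} → odd? (suc M) ≡ true → suc M ≤ n →
               opoB (suc M) n ≡ opoB M n ℕ.+ opoB M (n ∸ suc M) ℕ.+ opoB (suc M) (n ∸ suc M)
opoB-suc-odd {M} isOdd 1+M≤n with ℕ.m≤n⇒∃[o]m+o≡n 1+M≤n
... | r , refl rewrite ℕ.m+n∸m≡n (suc M) r | isOdd = begin
  opoB M (suc M ℕ.+ r) ℕ.+ sumTo (suc M ℕ.+ r) (copies M (suc M ℕ.+ r))
    ≡⟨ cong (opoB M (suc M ℕ.+ r) ℕ.+_) (sumTo-copies-suc M r) ⟩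
  opoB M (suc M ℕ.+ r) ℕ.+ (2 ℕ.* opoB M r ℕ.+ sumTo r (copies M r))
    ≡⟨ regroup (opoB M (suc M ℕ.+ r)) (opoB M r) (sumTo r (copies M r)) ⟩
  opoB M (suc M ℕ.+ r) ℕ.+ opoB M r ℕ.+ (opoB M r ℕ.+ sumTo r (copies M r))
    ∎
  where
  open ≡-Reasoning
  regroup : ∀ x y z → x ℕ.+ (2 ℕ.* y ℕ.+ z) ≡ x ℕ.+ y ℕ.+ (y ℕ.+ z)
  regroup = ℕ-Solver.solve-∀

pdoB-suc-below : ∀ {M n} → n < suc M → pdoB (suc M) n ≡ pdoB M n
pdoB-suc-below {M} {n} n<1+M
  rewrite dec-false (suc M ≤? n) (ℕ.<⇒≱ n<1+M) | ∧-zeroʳ (odd? (suc M)) = ℕ.+-identityʳ _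

pdoB-suc-even : ∀ {M n} → odd? (suc M) ≡ false → pdoB (suc M) n ≡ pdoB M n
pdoB-suc-even isEven rewrite isEven = ℕ.+-identityʳ _

pdoB-suc-odd : ∀ {M n} → odd? (suc M) ≡ true → suc M ≤ n →
               pdoB (suc M) n ≡ pdoB M n ℕ.+ pdoB M (n ∸ suc M)
pdoB-suc-odd {M} {n} isOdd 1+M≤n rewrite isOdd | dec-true (suc M ≤? n) 1+M≤n = refl

opoB-stable : ∀ {n M} → n ≤′ M → opoB M n ≡ opo n
opoB-stable ≤′-refl          = refl
opoB-stable (≤′-step n≤′M) = trans (opoB-suc-below (s≤s (ℕ.≤′⇒≤ n≤′M))) (opoB-stable n≤′M)

pdoB-stable : ∀ {n M} → n ≤′ M → pdoB M n ≡ pdo n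
pdoB-stable ≤′-refl          = refl
pdoB-stable (≤′-step n≤′M) = trans (pdoB-suc-below (s≤s (ℕ.≤′⇒≤ n≤′M))) (pdoB-stable n≤′M)

extℤ-cong : ∀ {F G} → (∀ n → F n ≡ G n) → extℤ F ≗ extℤ G
extℤ-cong F≡G (+ n)    = cong +_ (F≡G n)
extℤ-cong F≡G -[1+ t ] = refl

extℤ-sub : ∀ F {i n} → i ≤ n → extℤ F (+ n - + i) ≡ + F (n ∸ i)
extℤ-sub F {i} {n} i≤n = cong (extℤ F) (trans (ℤ.m-n≡m⊖n n i) (ℤ.⊖-≥ i≤n))

opoB-step : ∀ M → odd? (suc M) ≡ true →
            1-q^ suc M · extℤ (opoB (suc M)) ≗ 1+q^ suc M · extℤ (opoB M)
opoB-step M isOdd = isPowerSeries-ext (1-q^-isPowerSeries _ (extℤ-isPowerSeries _))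
                                      (1+q^-isPowerSeries _ (extℤ-isPowerSeries _)) coefficient
  where
  open ≡-Reasoning
  cancel : ∀ a b c → + (a ℕ.+ b ℕ.+ c) - + c ≡ + a + + b
  cancel a b c = trans (cong (_- + c) (trans (ℤ.pos-+ (a ℕ.+ b) c) (cong (_+ + c) (ℤ.pos-+ a b))))
                       (add-sub (+ a) (+ b) (+ c))
    where
    add-sub : ∀ x y z → x + y + z - z ≡ x + y
    add-sub = ℤ-Solver.solve-∀
  coefficient : ∀ n → (1-q^ suc M · extℤ (opoB (suc M))) (+ n) ≡ (1+q^ suc M · extℤ (opoB M)) (+ n)
  coefficient n with suc M ≤? n
  ... | yes 1+M≤n = begin
    + opoB (suc M) n - extℤ (opoB (suc M)) (+ n - + suc M)
      ≡⟨ cong (λ x → + opoB (suc M) n - x) (extℤ-sub (opoB (suc M)) 1+M≤n) ⟩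
    + opoB (suc M) n - + opoB (suc M) r
      ≡⟨ cong (λ x → + x - + opoB (suc M) r) (opoB-suc-odd isOdd 1+M≤n) ⟩
    + (opoB M n ℕ.+ opoB M r ℕ.+ opoB (suc M) r) - + opoB (suc M) r
      ≡⟨ cancel (opoB M n) (opoB M r) (opoB (suc M) r) ⟩
    + opoB M n + + opoB M r
      ≡⟨ cong (λ x → + opoB M n + x) (extℤ-sub (opoB M) 1+M≤n) ⟨
    + opoB M n + extℤ (opoB M) (+ n - + suc M)
      ∎
    where r = n ∸ suc M
  ... | no 1+M≰n = begin
    + opoB (suc M) n - extℤ (opoB (suc M)) (+ n - + suc M)
      ≡⟨ cong₂ _-_ (cong +_ (opoB-suc-below n<1+M)) (isPowerSeries-below (extℤ-isPowerSeries _) n<1+M) ⟩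
    + opoB M n + + 0
      ≡⟨ cong (λ x → + opoB M n + x) (isPowerSeries-below (extℤ-isPowerSeries _) n<1+M) ⟨
    + opoB M n + extℤ (opoB M) (+ n - + suc M)
      ∎
    where n<1+M = ℕ.≰⇒> 1+M≰n

pdoB-step : ∀ M → odd? (suc M) ≡ true → 1+q^ suc M · extℤ (pdoB M) ≗ extℤ (pdoB (suc M))
pdoB-step M isOdd = isPowerSeries-ext (1+q^-isPowerSeries _ (extℤ-isPowerSeries _))
                                      (extℤ-isPowerSeries _) coefficient
  where
  coefficient : ∀ n → (1+q^ suc M · extℤ (pdoB M)) (+ n) ≡ + pdoB (suc M) n
  coefficient n with suc M ≤? n
  ... | yes 1+M≤n = trans (cong (λ x → + pdoB M n + x) (extℤ-sub (pdoB M) 1+M≤n))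
                          (trans (sym (ℤ.pos-+ (pdoB M n) _)) (cong +_ (sym (pdoB-suc-odd isOdd 1+M≤n))))
  ... | no 1+M≰n = trans (cong (λ x → + pdoB M n + x) (isPowerSeries-below (extℤ-isPowerSeries _) n<1+M))
                         (trans (ℤ.+-identityʳ _) (cong +_ (sym (pdoB-suc-below n<1+M))))
    where n<1+M = ℕ.≰⇒> 1+M≰n

oddPoch-opoB : ∀ M → oddPoch M (extℤ (opoB M)) ≗ extℤ (pdoB M)
oddPoch-opoB zero = λ _ → refl
oddPoch-opoB (suc M) = by-parity (odd? (suc M)) refl
  where
  open ≗-Reasoning
  F = extℤ (opoB (suc M))
  unfold : ∀ {b} → odd? (suc M) ≡ b →
           oddPoch (suc M) F ≡ (if b then 1-q^ suc M · oddPoch M F else oddPoch M F)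
  unfold = cong (λ b → if b then 1-q^ suc M · oddPoch M F else oddPoch M F)
  by-parity : ∀ b → odd? (suc M) ≡ b → oddPoch (suc M) (extℤ (opoB (suc M))) ≗ extℤ (pdoB (suc M))
  by-parity true parity = begin
    oddPoch (suc M) (extℤ (opoB (suc M)))         ≡⟨ unfold parity ⟩
    1-q^ suc M · oddPoch M (extℤ (opoB (suc M)))  ≈⟨ 1-q^-oddPoch-comm (suc M) M _ ⟩
    oddPoch M (1-q^ suc M · extℤ (opoB (suc M)))  ≈⟨ oddPoch-cong M (opoB-step M parity) ⟩
    oddPoch M (1+q^ suc M · extℤ (opoB M))        ≈⟨ 1+q^-oddPoch-comm (suc M) M _ ⟨
    1+q^ suc M · oddPoch M (extℤ (opoB M))        ≈⟨ 1+q^-cong (suc M) (oddPoch-opoB M) ⟩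
    1+q^ suc M · extℤ (pdoB M)                    ≈⟨ pdoB-step M parity ⟩
    extℤ (pdoB (suc M))                           ∎
  by-parity false parity = begin
    oddPoch (suc M) (extℤ (opoB (suc M)))
      ≡⟨ unfold parity ⟩
    oddPoch M (extℤ (opoB (suc M)))
      ≈⟨ oddPoch-cong M (extℤ-cong (λ n → opoB-suc-even {M} {n} parity)) ⟩
    oddPoch M (extℤ (opoB M))
      ≈⟨ oddPoch-opoB M ⟩
    extℤ (pdoB M)
      ≈⟨ extℤ-cong (λ n → pdoB-suc-even {M} {n} parity) ⟨
    extℤ (pdoB (suc M))
      ∎

opo-agree : ∀ {n M} → n ≤ M → AgreeUpTo n (extℤ opo) (extℤ (opoB M))
opo-agree n≤M = extℤ-agree (λ m≤n → sym (opoB-stable (ℕ.≤⇒≤′ (ℕ.≤-trans m≤n n≤M))))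

pdo-agree : ∀ {n M} → n ≤ M → AgreeUpTo n (extℤ pdo) (extℤ (pdoB M))
pdo-agree n≤M = extℤ-agree (λ m≤n → sym (pdoB-stable (ℕ.≤⇒≤′ (ℕ.≤-trans m≤n n≤M))))

theorem3p11 : (n N : ℕ) → n ≤ N → lhsSum N n ≡ rhsSum N n
theorem3p11 n N n≤N = begin
  lhsSum N n
    ≡⟨ lhsSum≡coefficient n≤N ⟩
  qPoch 1 0 N P̄ (+ n)
    ≡⟨ qPoch-stable 0 (extℤ-isPowerSeries opo) n≤N (ℕ.≤⇒≤′ (≤-double N)) ⟨
  qPoch 1 0 (double N) P̄ (+ n)
    ≡⟨ qPoch-agree 1 0 (double N) (opo-agree n≤2N) ℤ.≤-refl ⟩
  qPoch 1 0 (double N) (extℤ (opoB (double N))) (+ n)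
    ≡⟨ qPoch-split N _ (+ n) ⟩
  qPoch 2 0 N (oddPoch (double N) (extℤ (opoB (double N)))) (+ n)
    ≡⟨ qPoch-cong 2 0 N (oddPoch-opoB (double N)) (+ n) ⟩
  qPoch 2 0 N (extℤ (pdoB (double N))) (+ n)
    ≡⟨ qPoch-agree 2 0 N (pdo-agree n≤2N) ℤ.≤-refl ⟨
  qPoch 2 0 N D (+ n)
    ≡⟨ rhsSum≡coefficient n≤N ⟨
  rhsSum N n
    ∎
  where
  open ≡-Reasoning
  P̄ = extℤ opo
  D = extℤ pdo
  n≤2N = ℕ.≤-trans n≤N (≤-double N)
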